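{- Let $\mathbf{M}=(M;\le,0,1)$ be a non-trivial complete lattice, let $S$ and $X$ be non-empty sets, and let $R\subseteq X\times S\times S$. Let $\mathbf{B}=(B;\le,0,1)$ be a bounded subposet of $\mathbf{M}^{S}$, and let $T_R=(T_{R_x})_{x\in X}\colon B\to (M^S)^X$ and $P_R=(P_{R_x})_{x\in X}\colon B\to (M^S)^X$ be the labelled upper and lower transition functors constructed by means of $R$. Then for all $a,b\in B$ and all $x\in X$, $$P_{R_x}(a)\le b\iff a\le T_{R_x}(b).$$ Moreover: (a) If $R=R_{T_R}$ and $T_{R_x}(b)\in B$ for all $x\in X$, $b\in B$, then $R=R_{T_R}=R^{P_R}$. (b) If $R=R^{P_R}$ and $P_{R_x}(b)\in B$ for all $x\in X$, $b\in B$, then $R=R_{T_R}=R^{P_R}$.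
   Context: $\mathbf{M}^S$ is the set of maps $S\to M$ ordered pointwise; a bounded subposet of $\mathbf{M}^S$ is a subset containing the constant maps $0,1$ with the induced order; $p(s)$ denotes the value of $p\in M^S$ at $s$. For $x\in X$ let $R_x=\{(s,t)\in S\times S\mid (x,s,t)\in R\}$, so $R=\bigcup_{x\in X}\{x\}\times R_x$. For $b\in B$ and $s,t\in S$ define $T_{R_x}(b)(s)=\bigwedge_M\{b(u)\mid (s,u)\in R_x\}$ and $P_{R_x}(b)(t)=\bigvee_M\{b(u)\mid (u,t)\in R_x\}$ (empty meet $=1$, empty join $=0$). For a family $T=(T_x)_{x\in X}$ of maps $B\to M^S$ define $R_{T_x}=\{(s,t)\mid \forall b\in B:\ T_x(b)(s)\le b(t)\}$ and $R_T=\bigcup_{x\in X}\{x\}\times R_{T_x}$; for a family $P=(P_x)_{x\in X}$ define $R^{P_x}=\{(s,t)\mid \forall a\in B:\ a(s)\le P_x(a)(t)\}$ and $R^{P}=\bigcup_{x\in X}\{x\}\times R^{P_x}$. Thus $R_{T_R}$ and $R^{P_R}$ are these relations for $T=T_R$ and $P=P_R$. -}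

module Defs where

open import Level using (0ℓ)
open import Data.Product using (Σ; _×_; _,_)
open import Data.Empty using (⊥)
open import Relation.Nullary using (¬_)
open import Function.Bundles using (_⇔_)
open import Relation.Binary.Bundles using (Poset)

record CompleteLattice : Set₁ where
  field
    poset : Poset 0ℓ 0ℓ 0ℓ
  open Poset poset public
  field
    ⋀ : (I : Set) → (I → Carrier) → Carrier
    ⋀-lower : ∀ (I : Set) (f : I → Carrier) (i : I) → ⋀ I f ≤ f i
    ⋀-greatest : ∀ (I : Set) (f : I → Carrier) (z : Carrier) →
                 (∀ i → z ≤ f i) → z ≤ ⋀ I f
    ⋁ : (I : Set) → (I → Carrier) → Carrier
    ⋁-upper : ∀ (I : Set) (f : I → Carrier) (i : I) → f i ≤ ⋁ I f
    ⋁-least : ∀ (I : Set) (f : I → Carrier) (z : Carrier) →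
              (∀ i → f i ≤ z) → ⋁ I f ≤ z

  𝟘 : Carrier
  𝟘 = ⋁ ⊥ (λ ())

  𝟙 : Carrier
  𝟙 = ⋀ ⊥ (λ ())

  NonTrivial : Set
  NonTrivial = ¬ (𝟘 ≈ 𝟙)

module _ (𝕄 : CompleteLattice) where
  open CompleteLattice 𝕄

  _≤ₚ_ : {S : Set} → (S → Carrier) → (S → Carrier) → Set
  p ≤ₚ q = ∀ s → p s ≤ q s

  IsBoundedSubposet : {S : Set} → ((S → Carrier) → Set) → Set
  IsBoundedSubposet B = B (λ _ → 𝟘) × B (λ _ → 𝟙)

  module _ {X S : Set} (R : X → S → S → Set) where
    T : X → (S → Carrier) → (S → Carrier)
    T x b s = ⋀ (Σ S (λ u → R x s u)) (λ { (u , _) → b u })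

    P : X → (S → Carrier) → (S → Carrier)
    P x b t = ⋁ (Σ S (λ u → R x u t)) (λ { (u , _) → b u })

  module _ {X S : Set} (B : (S → Carrier) → Set) where
    R-of-T : (X → (S → Carrier) → (S → Carrier)) → X → S → S → Set
    R-of-T Tf x s t = ∀ (b : S → Carrier) → B b → Tf x b s ≤ b t

    R-of-P : (X → (S → Carrier) → (S → Carrier)) → X → S → S → Set
    R-of-P Pf x s t = ∀ (a : S → Carrier) → B a → a s ≤ Pf x a t

_≐_ : {X S : Set} → (X → S → S → Set) → (X → S → S → Set) → Set
R ≐ R' = ∀ x s t → R x s t ⇔ R' x s t

module Submission where

open import Defs
open import Data.Product using (_×_; _,_)
open import Function.Bundles using (_⇔_; mk⇔; Equivalence)

-- P_{R_x} ⊣ T_{R_x} is a Galois connection on all of M^S, since both sides of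
-- the equivalence say a u ≤ b v for every (u , v) ∈ R_x.  Its unit and counit,
-- applied to members of B, relate R_T and R^P to each other as soon as B is
-- closed under T resp. P; together with R ⊆ R_T and R ⊆ R^P this gives (a), (b).

_⊆₃_ : {X S : Set} → (X → S → S → Set) → (X → S → S → Set) → Set
R ⊆₃ R' = ∀ x s t → R x s t → R' x s t

≐-squeeze : {X S : Set} {R R₁ R₂ : X → S → S → Set} →
            R ≐ R₁ → R ⊆₃ R₂ → R₂ ⊆₃ R₁ → R ≐ R₂
≐-squeeze R≐R₁ R⊆R₂ R₂⊆R₁ x s t =
  mk⇔ (R⊆R₂ x s t) (λ r₂ → Equivalence.from (R≐R₁ x s t) (R₂⊆R₁ x s t r₂))

module _ (𝕄 : CompleteLattice) {X S : Set} (R : X → S → S → Set) where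
  open CompleteLattice 𝕄

  private
    _≤ₘ_ : (S → Carrier) → (S → Carrier) → Set
    _≤ₘ_ = _≤ₚ_ 𝕄

    Tᴿ Pᴿ : X → (S → Carrier) → (S → Carrier)
    Tᴿ = T 𝕄 R
    Pᴿ = P 𝕄 R

  T-lower : ∀ x (b : S → Carrier) {s u} → R x s u → Tᴿ x b s ≤ b u
  T-lower x b {s} {u} r = ⋀-lower _ (λ { (v , _) → b v }) (u , r)

  P-upper : ∀ x (a : S → Carrier) {u t} → R x u t → a u ≤ Pᴿ x a t
  P-upper x a {u} {t} r = ⋁-upper _ (λ { (v , _) → a v }) (u , r)

  P≤⇒≤T : ∀ x {a b} → Pᴿ x a ≤ₘ b → a ≤ₘ Tᴿ x b
  P≤⇒≤T x {a} P≤b s = ⋀-greatest _ _ _ λ { (u , r) → trans (P-upper x a r) (P≤b u) }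

  ≤T⇒P≤ : ∀ x {a b} → a ≤ₘ Tᴿ x b → Pᴿ x a ≤ₘ b
  ≤T⇒P≤ x {a} {b} a≤T t = ⋁-least _ _ _ λ { (u , r) → trans (a≤T u) (T-lower x b r) }

  P⊣T : ∀ x a b → (Pᴿ x a ≤ₘ b) ⇔ (a ≤ₘ Tᴿ x b)
  P⊣T x a b = mk⇔ (P≤⇒≤T x) (≤T⇒P≤ x)

  ≤T∘P : ∀ x a → a ≤ₘ Tᴿ x (Pᴿ x a)
  ≤T∘P x a = P≤⇒≤T x (λ _ → refl)

  P∘T≤ : ∀ x b → Pᴿ x (Tᴿ x b) ≤ₘ b
  P∘T≤ x b = ≤T⇒P≤ x (λ _ → refl)

  module _ (B : (S → Carrier) → Set) where
    private
      Rᵀ Rᴾ : X → S → S → Set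
      Rᵀ = R-of-T 𝕄 B Tᴿ
      Rᴾ = R-of-P 𝕄 B Pᴿ

    R⊆R-of-T : R ⊆₃ Rᵀ
    R⊆R-of-T x s t r b _ = T-lower x b r

    R⊆R-of-P : R ⊆₃ Rᴾ
    R⊆R-of-P x s t r a _ = P-upper x a r

    R-of-P⊆R-of-T : (∀ x b → B b → B (Tᴿ x b)) → Rᴾ ⊆₃ Rᵀ
    R-of-P⊆R-of-T T-closed x s t h b Bb =
      trans (h (Tᴿ x b) (T-closed x b Bb)) (P∘T≤ x b t)

    R-of-T⊆R-of-P : (∀ x a → B a → B (Pᴿ x a)) → Rᵀ ⊆₃ Rᴾ
    R-of-T⊆R-of-P P-closed x s t h a Ba =
      trans (≤T∘P x a s) (h (Pᴿ x a) (P-closed x a Ba))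

theorem3 : (𝕄 : CompleteLattice) → CompleteLattice.NonTrivial 𝕄 →
    (S X : Set) → S → X → (R : X → S → S → Set) →
    (B : (S → CompleteLattice.Carrier 𝕄) → Set) → IsBoundedSubposet 𝕄 B →
    (∀ a b x → B a → B b →
       (_≤ₚ_ 𝕄 (P 𝕄 R x a) b ⇔ _≤ₚ_ 𝕄 a (T 𝕄 R x b)))
    × ((R ≐ R-of-T 𝕄 B (T 𝕄 R) → (∀ x b → B b → B (T 𝕄 R x b)) →
        (R ≐ R-of-T 𝕄 B (T 𝕄 R)) × (R ≐ R-of-P 𝕄 B (P 𝕄 R)))
    × (R ≐ R-of-P 𝕄 B (P 𝕄 R) → (∀ x b → B b → B (P 𝕄 R x b)) →
        (R ≐ R-of-T 𝕄 B (T 𝕄 R)) × (R ≐ R-of-P 𝕄 B (P 𝕄 R))))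
theorem3 𝕄 _ S X _ _ R B _ =
    (λ a b x _ _ → P⊣T 𝕄 R x a b)
  , (λ R≐Rᵀ T-closed →
       R≐Rᵀ , ≐-squeeze R≐Rᵀ (R⊆R-of-P 𝕄 R B) (R-of-P⊆R-of-T 𝕄 R B T-closed))
  , (λ R≐Rᴾ P-closed →
       ≐-squeeze R≐Rᴾ (R⊆R-of-T 𝕄 R B) (R-of-T⊆R-of-P 𝕄 R B P-closed) , R≐Rᴾ)
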